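{- Every graph $G$ of minimum degree at least 4 which has a connected asymmetric spanning subgraph of minimum degree at least 4 has a majority distinguishing edge coloring with 6 colors.
   Context: Graphs are finite, simple and undirected. An asymmetric spanning subgraph $H$ of $G$ is a subgraph with $V(H)=V(G)$ whose only automorphism is the identity. A majority edge coloring is an edge coloring such that for every vertex $u$ and every color $\alpha$, at most half of the edges incident with $u$ have color $\alpha$. It is distinguishing if the only automorphism $\varphi$ of $G$ with $c(\varphi(u)\varphi(v))=c(uv)$ for all edges $uv$ is the identity. -}

module Defs where

open import Data.Nat using (ℕ; _≤_; _*_)
open import Data.Bool using (Bool; true; false; _∧_)
open import Data.Fin using (Fin; _≟_)
open import Data.Fin.Permutation using (Permutation′; _⟨$⟩ʳ_)
open import Data.List using (List; length; filterᵇ; allFin)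
open import Relation.Nullary.Decidable using (⌊_⌋)
open import Relation.Binary.PropositionalEquality using (_≡_)

record Graph (n : ℕ) : Set where
  field
    adj   : Fin n → Fin n → Bool
    sym   : ∀ u v → adj u v ≡ adj v u
    irrefl : ∀ u → adj u u ≡ false
open Graph public

deg : ∀ {n} → Graph n → Fin n → ℕ
deg {n} G u = length (filterᵇ (adj G u) (allFin n))

MinDegAtLeast : ∀ {n} → ℕ → Graph n → Set
MinDegAtLeast k G = ∀ u → k ≤ deg G u

SpanningSubgraph : ∀ {n} → Graph n → Graph n → Set
SpanningSubgraph H G = ∀ u v → adj H u v ≡ true → adj G u v ≡ true

data Walk {n} (G : Graph n) : Fin n → Fin n → Set where
  here : ∀ {u} → Walk G u u
  step : ∀ {u v w} → adj G u v ≡ true → Walk G v w → Walk G u w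

Connected : ∀ {n} → Graph n → Set
Connected {n} G = ∀ (u v : Fin n) → Walk G u v

IsAutomorphism : ∀ {n} → Graph n → Permutation′ n → Set
IsAutomorphism G φ = ∀ u v → adj G (φ ⟨$⟩ʳ u) (φ ⟨$⟩ʳ v) ≡ adj G u v

Asymmetric : ∀ {n} → Graph n → Set
Asymmetric {n} G = ∀ (φ : Permutation′ n) → IsAutomorphism G φ → ∀ x → φ ⟨$⟩ʳ x ≡ x

record EdgeColoring {n} (G : Graph n) (k : ℕ) : Set where
  field
    col    : Fin n → Fin n → Fin k
    colSym : ∀ u v → adj G u v ≡ true → col u v ≡ col v u
open EdgeColoring public

colDeg : ∀ {n k} {G : Graph n} → EdgeColoring G k → Fin n → Fin k → ℕ
colDeg {n} {G = G} c u α =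
  length (filterᵇ (λ v → adj G u v ∧ ⌊ col c u v ≟ α ⌋) (allFin n))

Majority : ∀ {n k} {G : Graph n} → EdgeColoring G k → Set
Majority {G = G} c = ∀ u α → 2 * colDeg c u α ≤ deg G u

Distinguishing : ∀ {n k} {G : Graph n} → EdgeColoring G k → Set
Distinguishing {n} {G = G} c =
  ∀ (φ : Permutation′ n) → IsAutomorphism G φ →
  (∀ u v → adj G u v ≡ true → col c (φ ⟨$⟩ʳ u) (φ ⟨$⟩ʳ v) ≡ col c u v) →
  ∀ x → φ ⟨$⟩ʳ x ≡ x

-- Every graph has a red/blue edge colouring in which the red and the blue degree of each vertex differ
-- by at most 2. This is proved by splitting off pairs of edges at a vertex: a path a – x – b becomes a
-- single edge ab whose two ends must get different colours, so the induction runs over a multigraph of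
-- monochromatic edges together with one of bicoloured edges, and ends at maximum degree 1.
--
-- Halving H twice and G ∖ H once gives six colour classes. A quarter of H has degree at most
-- ((d_H + 2)/2 + 2)/2, which is at most d_H / 2 because d_H ≥ 4; a half of G ∖ H has degree at most
-- (d_G − d_H + 2)/2 ≤ d_G / 2 because d_H ≥ 2. The first four colours are exactly the edges of H, so a
-- colour-preserving automorphism of G is an automorphism of H, hence the identity.

module Submission where

open import Defs hiding (sym)
open import Data.Nat using (ℕ)
open import Data.Product using (Σ; _×_)

open import Data.Nat.Properties hiding (_≟_; _<?_)
open import Algebra.Properties.CommutativeSemigroup +-commutativeSemigroup
  using (interchange; xy∙z≈xz∙y; x∙yz≈xz∙y)
open import Algebra.Properties.Semiring.Sum +-*-semiring
  using (sum; sum-syntax; sum-cong-≗; ∑-distrib-+; *-distribˡ-sum; *-distribʳ-sum; sum-replicate-zero)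
open import Data.Bool using (Bool; true; false; if_then_else_; _∧_; not)
open import Data.Fin using (Fin; zero; suc; _≟_; _<?_)
open import Data.Fin.Patterns using (0F; 1F; 2F; 3F; 4F; 5F)
open import Data.Fin.Permutation using (_⟨$⟩ʳ_)
open import Data.Fin.Properties using (any?)
import Data.Fin.Properties as Fin
open import Data.List using (length; filterᵇ; allFin; tabulate)
open import Data.Nat using (zero; suc; _+_; _*_; _∸_; _≤_; _<_; z≤n; s≤s; s≤s⁻¹; _≤?_; _<ᵇ_)
open import Data.Nat.Tactic.RingSolver using (solve-∀)
open import Data.Product using (_,_; ∃-syntax; proj₁; proj₂)
open import Data.Sum using (_⊎_; inj₁; inj₂; [_,_]′)
import Data.Sum as Sum
open import Function using (_∘_; id)
open import Relation.Binary.Definitions using (tri<; tri≈; tri>)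
open import Relation.Binary.PropositionalEquality
open import Relation.Nullary using (¬_; yes; no; does; contradiction)
open import Relation.Nullary.Decidable using (dec-true; dec-false; ⌊_⌋)

δ : ∀ {n} → Fin n → Fin n → ℕ
δ zero    zero    = 1
δ zero    (suc _) = 0
δ (suc _) zero    = 0
δ (suc i) (suc j) = δ i j

δ-refl : ∀ {n} (i : Fin n) → δ i i ≡ 1
δ-refl zero    = refl
δ-refl (suc i) = δ-refl i

δ-≢ : ∀ {n} {i j : Fin n} → i ≢ j → δ i j ≡ 0
δ-≢ {i = zero}  {zero}  i≢j = contradiction refl i≢j
δ-≢ {i = zero}  {suc j} _   = refl
δ-≢ {i = suc i} {zero}  _   = refl
δ-≢ {i = suc i} {suc j} i≢j = δ-≢ (i≢j ∘ cong suc)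

∑-δ : ∀ {n} (j : Fin n) → ∑[ i < n ] δ i j ≡ 1
∑-δ {suc n} zero    = cong suc (sum-replicate-zero n)
∑-δ {suc n} (suc j) = ∑-δ j

∑-mono : ∀ {n} {f g : Fin n → ℕ} → (∀ i → f i ≤ g i) → sum f ≤ sum g
∑-mono {zero}  f≤g = z≤n
∑-mono {suc n} f≤g = +-mono-≤ (f≤g zero) (∑-mono (f≤g ∘ suc))

Mat : ℕ → Set
Mat n = Fin n → Fin n → ℕ

infixl 6 _⊕_ _⊖_
infix  4 _≐_

_⊕_ _⊖_ : ∀ {n} → Mat n → Mat n → Mat n
(f ⊕ g) u v = f u v + g u v
(f ⊖ g) u v = f u v ∸ g u v

_ᵀ : ∀ {n} → Mat n → Mat n
(f ᵀ) u v = f v u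

_≐_ : ∀ {n} → Mat n → Mat n → Set
f ≐ g = ∀ u v → f u v ≡ g u v

𝟘 : ∀ {n} → Mat n
𝟘 _ _ = 0

≐-refl : ∀ {n} {f : Mat n} → f ≐ f
≐-refl _ _ = refl

≐-sym : ∀ {n} {f g : Mat n} → f ≐ g → g ≐ f
≐-sym f≐g u v = sym (f≐g u v)

≐-trans : ∀ {n} {f g h : Mat n} → f ≐ g → g ≐ h → f ≐ h
≐-trans f≐g g≐h u v = trans (f≐g u v) (g≐h u v)

⊕-cong : ∀ {n} {f f′ g g′ : Mat n} → f ≐ f′ → g ≐ g′ → f ⊕ g ≐ f′ ⊕ g′
⊕-cong f≐f′ g≐g′ u v = cong₂ _+_ (f≐f′ u v) (g≐g′ u v)

⊕-comm : ∀ {n} (f g : Mat n) → f ⊕ g ≐ g ⊕ f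
⊕-comm f g u v = +-comm (f u v) (g u v)

⊕-interchange : ∀ {n} (f g h k : Mat n) → (f ⊕ g) ⊕ (h ⊕ k) ≐ (f ⊕ h) ⊕ (g ⊕ k)
⊕-interchange f g h k u v = interchange (f u v) (g u v) (h u v) (k u v)

⊖-⊕ : ∀ {n} {f g : Mat n} → (∀ u v → g u v ≤ f u v) → f ≐ (f ⊖ g) ⊕ g
⊖-⊕ g≤f u v = sym (m∸n+n≡m (g≤f u v))

≐⊕-trans : ∀ {n} {f g h e₁ e₂ : Mat n} → f ≐ g ⊕ e₂ → g ≐ h ⊕ e₁ → f ≐ h ⊕ (e₁ ⊕ e₂)
≐⊕-trans {h = h} {e₁} {e₂} f≐ g≐ u v =
  trans (f≐ u v) (trans (cong (_+ e₂ u v) (g≐ u v)) (+-assoc (h u v) (e₁ u v) (e₂ u v)))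

unit : ∀ {n} → Fin n → Fin n → Mat n
unit a b u v = δ u a * δ v b

edge : ∀ {n} → Fin n → Fin n → Mat n
edge a b = unit a b ⊕ unit a b ᵀ

unit-cases : ∀ {n} (a b u v : Fin n) → (u ≡ a × v ≡ b) ⊎ unit a b u v ≡ 0
unit-cases a b u v with u ≟ a | v ≟ b
... | yes refl | yes refl = inj₁ (refl , refl)
... | yes refl | no v≢b   = inj₂ (trans (cong (δ a a *_) (δ-≢ v≢b)) (*-zeroʳ (δ a a)))
... | no u≢a   | _        = inj₂ (cong (_* δ v b) (δ-≢ u≢a))

unit-at : ∀ {n} (a b : Fin n) → unit a b a b ≡ 1
unit-at a b = cong₂ _*_ (δ-refl a) (δ-refl b)

unit-off : ∀ {n} (a b u v : Fin n) → u ≢ a ⊎ v ≢ b → unit a b u v ≡ 0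
unit-off a b u v off with unit-cases a b u v
... | inj₁ (refl , refl) with off
...   | inj₁ a≢a = contradiction refl a≢a
...   | inj₂ b≢b = contradiction refl b≢b
unit-off _ _ _ _ _ | inj₂ is0 = is0

unit-≤ : ∀ {n} {f : Mat n} {a b : Fin n} → 1 ≤ f a b → ∀ u v → unit a b u v ≤ f u v
unit-≤ {f = f} {a} {b} 1≤fab u v with unit-cases a b u v
... | inj₁ (refl , refl) = subst (_≤ f a b) (sym (unit-at a b)) 1≤fab
... | inj₂ is0           = subst (_≤ f u v) (sym is0) z≤n

edge-symmetric : ∀ {n} (a b : Fin n) → edge a b ≐ edge a b ᵀ
edge-symmetric a b u v = +-comm (unit a b u v) (unit a b v u)

edge-comm : ∀ {n} (a b : Fin n) → edge a b ≐ edge b a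
edge-comm a b u v =
  trans (+-comm (unit a b u v) (unit a b v u)) (cong₂ _+_ (*-comm (δ v a) (δ u b)) (*-comm (δ u a) (δ v b)))

edge-loopless : ∀ {n} {a b : Fin n} → a ≢ b → ∀ u → edge a b u u ≡ 0
edge-loopless {a = a} {b} a≢b u = cong₂ _+_ unit-uu unit-uu
  where
  unit-uu : unit a b u u ≡ 0
  unit-uu with u ≟ a
  ... | yes refl = unit-off a b a a (inj₂ a≢b)
  ... | no u≢a   = unit-off a b u u (inj₁ u≢a)

edge-at : ∀ {n} {x a : Fin n} → x ≢ a → edge x a x a ≡ 1
edge-at {x = x} {a} x≢a = cong₂ _+_ (unit-at x a) (unit-off x a a x (inj₁ (x≢a ∘ sym)))

edge-off : ∀ {n} {x a b : Fin n} → x ≢ a → b ≢ a → edge x a x b ≡ 0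
edge-off {x = x} {a} {b} x≢a b≢a = cong₂ _+_ (unit-off x a x b (inj₂ b≢a)) (unit-off x a b x (inj₂ x≢a))

edge-≤ : ∀ {n} {f : Mat n} {x a : Fin n} → f ≐ f ᵀ → x ≢ a → 1 ≤ f x a → ∀ u v → edge x a u v ≤ f u v
edge-≤ {f = f} {x} {a} f-sym x≢a 1≤fxa u v with unit-cases x a u v | unit-cases x a v u
... | inj₁ (refl , refl) | inj₁ (refl , _) = contradiction refl x≢a
... | inj₁ (refl , refl) | inj₂ is0 = subst (_≤ f x a) (sym (cong₂ _+_ (unit-at x a) is0)) 1≤fxa
... | inj₂ is0 | inj₁ (refl , refl) =
  subst (_≤ f a x) (sym (cong₂ _+_ is0 (unit-at x a))) (subst (1 ≤_) (f-sym x a) 1≤fxa)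
... | inj₂ is0 | inj₂ is0′ = subst (_≤ f u v) (sym (cong₂ _+_ is0 is0′)) z≤n

row : ∀ {n} → Mat n → Fin n → ℕ
row {n} f v = ∑[ w < n ] f v w

row-cong : ∀ {n} {f g : Mat n} → f ≐ g → ∀ v → row f v ≡ row g v
row-cong f≐g v = sum-cong-≗ (f≐g v)

row-mono : ∀ {n} {f g : Mat n} → (∀ u v → f u v ≤ g u v) → ∀ v → row f v ≤ row g v
row-mono f≤g v = ∑-mono (f≤g v)

row-⊕ : ∀ {n} (f g : Mat n) v → row (f ⊕ g) v ≡ row f v + row g v
row-⊕ f g v = ∑-distrib-+ (f v) (g v)

row-𝟘 : ∀ {n} (v : Fin n) → row 𝟘 v ≡ 0
row-𝟘 {n} _ = sum-replicate-zero n

row-unit : ∀ {n} (a b v : Fin n) → row (unit a b) v ≡ δ v a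
row-unit {n} a b v = begin
  (∑[ w < n ] (δ v a * δ w b))  ≡⟨ *-distribˡ-sum (δ v a) (λ w → δ w b) ⟨
  δ v a * (∑[ w < n ] δ w b)  ≡⟨ cong (δ v a *_) (∑-δ b) ⟩
  δ v a * 1                 ≡⟨ *-identityʳ (δ v a) ⟩
  δ v a                     ∎
  where open ≡-Reasoning

row-unitᵀ : ∀ {n} (a b v : Fin n) → row (unit a b ᵀ) v ≡ δ v b
row-unitᵀ {n} a b v = begin
  (∑[ w < n ] (δ w a * δ v b))  ≡⟨ *-distribʳ-sum (δ v b) (λ w → δ w a) ⟨
  (∑[ w < n ] δ w a) * δ v b  ≡⟨ cong (_* δ v b) (∑-δ a) ⟩
  1 * δ v b                 ≡⟨ *-identityˡ (δ v b) ⟩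
  δ v b                     ∎
  where open ≡-Reasoning

row-edge : ∀ {n} (a b v : Fin n) → row (edge a b) v ≡ δ v a + δ v b
row-edge a b v = trans (row-⊕ (unit a b) (unit a b ᵀ) v) (cong₂ _+_ (row-unit a b v) (row-unitᵀ a b v))

size : ∀ {n} → Mat n → ℕ
size {n} f = ∑[ u < n ] row f u

size-cong : ∀ {n} {f g : Mat n} → f ≐ g → size f ≡ size g
size-cong f≐g = sum-cong-≗ (row-cong f≐g)

size-⊕ : ∀ {n} (f g : Mat n) → size (f ⊕ g) ≡ size f + size g
size-⊕ f g = trans (sum-cong-≗ (row-⊕ f g)) (∑-distrib-+ (row f) (row g))

size-edge : ∀ {n} (a b : Fin n) → size (edge a b) ≡ 2
size-edge a b = trans (size-⊕ (unit a b) (unit a b ᵀ))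
  (cong₂ _+_ (trans (sum-cong-≗ (row-unit a b)) (∑-δ a)) (trans (sum-cong-≗ (row-unitᵀ a b)) (∑-δ b)))

size-⊕-edge : ∀ {n} (f : Mat n) (a b : Fin n) → size (f ⊕ edge a b) ≡ size f + 2
size-⊕-edge f a b = trans (size-⊕ f (edge a b)) (cong (size f +_) (size-edge a b))

size-two-edges : ∀ {n} (f : Mat n) (x a y b : Fin n) → size (f ⊕ (edge x a ⊕ edge y b)) ≡ size f + 4
size-two-edges f x a y b =
  trans (size-⊕ f _)
    (cong (size f +_) (trans (size-⊕ (edge x a) (edge y b)) (cong₂ _+_ (size-edge x a) (size-edge y b))))

record Multigraph {n} (f : Mat n) : Set where
  field
    symmetric : f ≐ f ᵀ
    loopless  : ∀ u → f u u ≡ 0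

𝟘-multigraph : ∀ {n} → Multigraph {n} 𝟘
𝟘-multigraph = record { symmetric = ≐-refl ; loopless = λ _ → refl }

off-diagonal : ∀ {n} {f : Mat n} {x a : Fin n} → Multigraph f → 1 ≤ f x a → x ≢ a
off-diagonal mf 1≤fxa refl = contradiction (subst (1 ≤_) (Multigraph.loopless mf _) 1≤fxa) λ ()

remove-edge : ∀ {n} {f : Mat n} {x a : Fin n} → Multigraph f → 1 ≤ f x a →
  Σ (Mat n) λ g → Multigraph g × f ≐ g ⊕ edge x a
remove-edge {f = f} {x} {a} mf 1≤fxa = f ⊖ edge x a , mg , ⊖-⊕ (edge-≤ symmetric (off-diagonal mf 1≤fxa) 1≤fxa)
  where
  open Multigraph mf
  mg : Multigraph (f ⊖ edge x a)
  mg = record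
    { symmetric = λ u v → cong₂ _∸_ (symmetric u v) (edge-symmetric x a u v)
    ; loopless  = λ u → trans (cong (_∸ edge x a u u) (loopless u)) (0∸n≡0 (edge x a u u)) }

remove-double-edge : ∀ {n} {f : Mat n} {x w : Fin n} → Multigraph f → 2 ≤ f x w →
  Σ (Mat n) λ h → Multigraph h × f ≐ h ⊕ (edge x w ⊕ edge x w)
remove-double-edge {x = x} {w} mf 2≤fxw with remove-edge mf (≤-trans (s≤s z≤n) 2≤fxw)
... | g , mg , f≐ with remove-edge mg 1≤gxw
  where
  1≤gxw : 1 ≤ g x w
  1≤gxw = +-cancelʳ-≤ 1 1 (g x w)
    (subst (2 ≤_) (trans (f≐ x w) (cong (g x w +_) (edge-at (off-diagonal mf (≤-trans (s≤s z≤n) 2≤fxw))))) 2≤fxw)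
...   | h , mh , g≐ = h , mh , ≐⊕-trans {h = h} {edge x w} {edge x w} f≐ g≐

remove-path : ∀ {n} {f : Mat n} {x a b : Fin n} → Multigraph f → a ≢ b → 1 ≤ f x a → 1 ≤ f x b →
  Σ (Mat n) λ h → Multigraph h × f ≐ h ⊕ (edge x a ⊕ edge x b)
remove-path {x = x} {a} {b} mf a≢b 1≤fxa 1≤fxb with remove-edge mf 1≤fxb
... | g , mg , f≐ with remove-edge mg 1≤gxa
  where
  1≤gxa : 1 ≤ g x a
  1≤gxa = subst (1 ≤_)
    (trans (f≐ x a) (trans (cong (g x a +_) (edge-off (off-diagonal mf 1≤fxb) a≢b)) (+-identityʳ (g x a)))) 1≤fxa
...   | h , mh , g≐ = h , mh , ≐⊕-trans {h = h} {edge x a} {edge x b} f≐ g≐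

⊕-edge-multigraph : ∀ {n} {f : Mat n} {a b : Fin n} → Multigraph f → a ≢ b → Multigraph (f ⊕ edge a b)
⊕-edge-multigraph {a = a} {b} mf a≢b = record
  { symmetric = ⊕-cong symmetric (edge-symmetric a b)
  ; loopless  = λ u → cong₂ _+_ (loopless u) (edge-loopless a≢b u) }
  where open Multigraph mf

orients-⊕ : ∀ {n} (o g : Mat n) {M N : Mat n} →
  o ⊕ o ᵀ ≐ M → g ⊕ g ᵀ ≐ N → (o ⊕ g) ⊕ (o ⊕ g) ᵀ ≐ M ⊕ N
orients-⊕ o g o-orients g-orients =
  ≐-trans (⊕-interchange o g (o ᵀ) (g ᵀ)) (⊕-cong o-orients g-orients)

orients-remove : ∀ {n} {o′ M : Mat n} (o g : Mat n) →
  o′ ≐ o ⊕ g → o′ ⊕ o′ ᵀ ≐ M ⊕ (g ⊕ g ᵀ) → o ⊕ o ᵀ ≐ M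
orients-remove o g o′≐ o′-orients u v = +-cancelʳ-≡ (g u v + g v u) _ _
  (trans (sym (⊕-interchange o g (o ᵀ) (g ᵀ) u v))
    (trans (sym (cong₂ _+_ (o′≐ u v) (o′≐ v u))) (o′-orients u v)))

oriented-somewhere : ∀ {n} {o M : Mat n} {a b : Fin n} →
  a ≢ b → o ⊕ o ᵀ ≐ M ⊕ edge a b → 1 ≤ o a b ⊎ 1 ≤ o b a
oriented-somewhere {o = o} {M} {a} {b} a≢b o-orients with o a b in oab
... | suc _ = inj₁ (s≤s z≤n)
... | zero  = inj₂ (subst (1 ≤_) (sym o-ba) (subst (1 ≤_) (+-comm 1 (M a b)) (s≤s z≤n)))
  where
  o-ba : o b a ≡ M a b + 1
  o-ba = trans (sym (cong (_+ o b a) oab)) (trans (o-orients a b) (cong (M a b +_) (edge-at a≢b)))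

upper : ∀ {n} → Mat n → Mat n
upper M u v = if does (u <? v) then M u v else 0

upper-≤ : ∀ {n} (M : Mat n) u v → upper M u v ≤ M u v
upper-≤ M u v with does (u <? v)
... | true  = ≤-refl
... | false = z≤n

upper-orients : ∀ {n} {M : Mat n} → Multigraph M → upper M ⊕ upper M ᵀ ≐ M
upper-orients {M = M} mM u v with Fin.<-cmp u v
... | tri< u<v _ v≮u rewrite dec-true (u <? v) u<v | dec-false (v <? u) v≮u = +-identityʳ (M u v)
... | tri≈ _ refl _  rewrite dec-false (u <? u) (Fin.<-irrefl refl) = sym (Multigraph.loopless mM u)
... | tri> u≮v _ v<u rewrite dec-false (u <? v) u≮v | dec-true (v <? u) v<u = sym (Multigraph.symmetric mM u v)

Near : ℕ → ℕ → Set
Near p q = p ≤ q + 2 × q ≤ p + 2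

near-shift : ∀ {p q p′ q′} e → Near p q → p′ ≡ p + e → q′ ≡ q + e → Near p′ q′
near-shift {p} {q} e (p≤ , q≤) refl refl = shift p q p≤ , shift q p q≤
  where
  shift : ∀ r s → r ≤ s + 2 → r + e ≤ s + e + 2
  shift r s r≤ = subst (r + e ≤_) (xy∙z≈xz∙y s 2 e) (+-monoˡ-≤ e r≤)

ends : ∀ {n} → Mat n → Mat n → Fin n → ℕ
ends f o v = row f v + row o v

ends-cong : ∀ {n} (f : Mat n) {o o′ : Mat n} → o ≐ o′ → ∀ v → ends f o v ≡ ends f o′ v
ends-cong f o≐o′ v = cong (row f v +_) (row-cong o≐o′ v)

ends-⊕ˡ : ∀ {n} (f g o : Mat n) v → ends (f ⊕ g) o v ≡ ends f o v + row g v
ends-⊕ˡ f g o v = trans (cong (_+ row o v) (row-⊕ f g v)) (xy∙z≈xz∙y (row f v) (row g v) (row o v))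

ends-⊕ʳ : ∀ {n} (f o g : Mat n) v → ends f (o ⊕ g) v ≡ ends f o v + row g v
ends-⊕ʳ f o g v = trans (cong (row f v +_) (row-⊕ o g v)) (sym (+-assoc (row f v) (row o v) (row g v)))

ends-exchangeˡ : ∀ {n} (f e : Mat n) {o o′ g : Mat n} {d : ℕ} {v : Fin n} →
  o′ ≐ o ⊕ g → row e v ≡ d + row g v → ends (f ⊕ e) o v ≡ ends f o′ v + d
ends-exchangeˡ f e {o} {o′} {g} {d} {v} o′≐ row-e = begin
  ends (f ⊕ e) o v            ≡⟨ ends-⊕ˡ f e o v ⟩
  ends f o v + row e v        ≡⟨ cong (ends f o v +_) row-e ⟩
  ends f o v + (d + row g v)  ≡⟨ x∙yz≈xz∙y (ends f o v) d (row g v) ⟩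
  ends f o v + row g v + d    ≡⟨ cong (_+ d) (ends-⊕ʳ f o g v) ⟨
  ends f (o ⊕ g) v + d        ≡⟨ cong (_+ d) (ends-cong f o′≐ v) ⟨
  ends f o′ v + d             ∎
  where open ≡-Reasoning

ends-exchangeʳ : ∀ {n} (f h : Mat n) {o o′ g : Mat n} {d : ℕ} {v : Fin n} →
  o′ ≐ o ⊕ g → row h v ≡ row g v + d → ends f (o ⊕ h) v ≡ ends f o′ v + d
ends-exchangeʳ f h {o} {o′} {g} {d} {v} o′≐ row-h = begin
  ends f (o ⊕ h) v            ≡⟨ ends-⊕ʳ f o h v ⟩
  ends f o v + row h v        ≡⟨ cong (ends f o v +_) row-h ⟩
  ends f o v + (row g v + d)  ≡⟨ +-assoc (ends f o v) (row g v) d ⟨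
  ends f o v + row g v + d    ≡⟨ cong (_+ d) (ends-⊕ʳ f o g v) ⟨
  ends f (o ⊕ g) v + d        ≡⟨ cong (_+ d) (ends-cong f o′≐ v) ⟨
  ends f o′ v + d             ∎
  where open ≡-Reasoning

-- A colouring of the edge-ends of the multigraph C + M: both ends of an edge of C get the same colour,
-- the two ends of an edge of M get different colours, recorded by orienting it from its red end to its
-- blue end.
record Balanced {n} (C M : Mat n) : Set where
  field
    red blue out : Mat n
    colours      : red ⊕ blue ≐ C
    red-sym      : red ≐ red ᵀ
    orients      : out ⊕ out ᵀ ≐ M
    balanced     : ∀ v → Near (ends red out v) (ends blue (out ᵀ) v)

Balanced-cong : ∀ {n} {C C′ M M′ : Mat n} → C ≐ C′ → M ≐ M′ → Balanced C M → Balanced C′ M′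
Balanced-cong C≐C′ M≐M′ S = record
  { red      = red
  ; blue     = blue
  ; out      = out
  ; colours  = ≐-trans colours C≐C′
  ; red-sym  = red-sym
  ; orients  = ≐-trans orients M≐M′
  ; balanced = balanced }
  where open Balanced S

weight : ∀ {n} → Mat n → Mat n → ℕ
weight C M = size C + size M

lighter : ∀ {p q} k → p ≡ q + suc k → q < p
lighter {q = q} k refl = m<m+n q (s≤s z≤n)

Below : ∀ {n} → Mat n → Mat n → Set
Below {n} C M =
  ∀ {C′ M′ : Mat n} → Multigraph C′ → Multigraph M′ → weight C′ M′ < weight C M → Balanced C′ M′

balanced-sparse : ∀ {n} {C M : Mat n} → Multigraph C → Multigraph M →
  (∀ v → row C v ≤ 1) → (∀ v → row M v ≤ 1) → Balanced C M
balanced-sparse {C = C} {M} mC mM C-sparse M-sparse = record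
  { red      = C
  ; blue     = 𝟘
  ; out      = upper M
  ; colours  = λ u v → +-identityʳ (C u v)
  ; red-sym  = Multigraph.symmetric mC
  ; orients  = upper-orients mM
  ; balanced = λ v → ≤-trans (red-ends v) (m≤n+m 2 _) , ≤-trans (blue-ends v) (≤-trans (n≤1+n 1) (m≤n+m 2 _)) }
  where
  row-upper-≤ : ∀ v → row (upper M) v ≤ 1
  row-upper-≤ v = ≤-trans (row-mono (upper-≤ M) v) (M-sparse v)
  row-upperᵀ-≤ : ∀ v → row (upper M ᵀ) v ≤ 1
  row-upperᵀ-≤ v = ≤-trans (row-mono (λ u w → upper-≤ M w u) v)
                           (subst (_≤ 1) (row-cong (Multigraph.symmetric mM) v) (M-sparse v))
  red-ends : ∀ v → ends C (upper M) v ≤ 2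
  red-ends v = +-mono-≤ (C-sparse v) (row-upper-≤ v)
  blue-ends : ∀ v → ends 𝟘 (upper M ᵀ) v ≤ 1
  blue-ends v = subst (λ z → z + row (upper M ᵀ) v ≤ 1) (sym (row-𝟘 v)) (row-upperᵀ-≤ v)

reduce-mono-double : ∀ {n} {C M : Mat n} {x w : Fin n} →
  Multigraph C → Multigraph M → Below C M → 2 ≤ C x w → Balanced C M
reduce-mono-double {C = C} {M} {x} {w} mC mM below 2≤Cxw with remove-double-edge mC 2≤Cxw
... | C′ , mC′ , C≐ = record
  { red      = red ⊕ edge x w
  ; blue     = blue ⊕ edge x w
  ; out      = out
  ; colours  = ≐-trans (⊕-interchange red (edge x w) blue (edge x w)) (≐-trans (⊕-cong colours ≐-refl) (≐-sym C≐))
  ; red-sym  = ⊕-cong red-sym (edge-symmetric x w)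
  ; orients  = orients
  ; balanced = λ v → near-shift (row (edge x w) v) (balanced v)
                       (ends-⊕ˡ red (edge x w) out v) (ends-⊕ˡ blue (edge x w) (out ᵀ) v) }
  where
  weight-C : weight C M ≡ weight C′ M + 4
  weight-C = trans (cong (_+ size M) (trans (size-cong C≐) (size-two-edges C′ x w x w)))
                   (xy∙z≈xz∙y (size C′) 4 (size M))
  open Balanced (below mC′ mM (lighter 3 weight-C))

reduce-bi-double : ∀ {n} {C M : Mat n} {x w : Fin n} →
  Multigraph C → Multigraph M → Below C M → 2 ≤ M x w → Balanced C M
reduce-bi-double {C = C} {M} {x} {w} mC mM below 2≤Mxw with remove-double-edge mM 2≤Mxw
... | M′ , mM′ , M≐ = record
  { red      = red
  ; blue     = blue
  ; out      = out ⊕ edge x w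
  ; colours  = colours
  ; red-sym  = red-sym
  ; orients  = ≐-trans (orients-⊕ out (edge x w) orients edge-orients) (≐-sym M≐)
  ; balanced = λ v → near-shift (row (edge x w) v) (balanced v) (ends-⊕ʳ red out (edge x w) v) (blue-ends v) }
  where
  weight-M : weight C M ≡ weight C M′ + 4
  weight-M = trans (cong (size C +_) (trans (size-cong M≐) (size-two-edges M′ x w x w)))
                   (sym (+-assoc (size C) (size M′) 4))
  open Balanced (below mC mM′ (lighter 3 weight-M))
  edge-orients : edge x w ⊕ edge x w ᵀ ≐ edge x w ⊕ edge x w
  edge-orients = ⊕-cong {f = edge x w} ≐-refl (≐-sym (edge-symmetric x w))
  blue-ends : ∀ v → ends blue ((out ⊕ edge x w) ᵀ) v ≡ ends blue (out ᵀ) v + row (edge x w) v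
  blue-ends v = trans (ends-⊕ʳ blue (out ᵀ) (edge x w ᵀ) v)
                      (cong (ends blue (out ᵀ) v +_) (row-cong (≐-sym (edge-symmetric x w)) v))

-- The path a – x – b of monochromatic edges is split off into a bicoloured edge ab; colouring xa like
-- the a-end and xb like the b-end of ab changes nothing except that x gains one red and one blue end.
reroute-mono : ∀ {n} {C C′ M : Mat n} {x a b : Fin n} → C ≐ C′ ⊕ (edge x a ⊕ edge x b) →
  (S : Balanced C′ (M ⊕ edge a b)) → 1 ≤ Balanced.out S a b → Balanced C M
reroute-mono {x = x} {a} {b} C≐ S 1≤out = record
  { red      = red ⊕ edge x a
  ; blue     = blue ⊕ edge x b
  ; out      = out₀
  ; colours  = ≐-trans (⊕-interchange red (edge x a) blue (edge x b)) (≐-trans (⊕-cong colours ≐-refl) (≐-sym C≐))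
  ; red-sym  = ⊕-cong red-sym (edge-symmetric x a)
  ; orients  = orients-remove out₀ (unit a b) out≐ orients
  ; balanced = λ v → near-shift (δ v x) (balanced v) (red-ends v) (blue-ends v) }
  where
  open Balanced S
  out₀ : Mat _
  out₀ = out ⊖ unit a b
  out≐ : out ≐ out₀ ⊕ unit a b
  out≐ = ⊖-⊕ (unit-≤ 1≤out)
  red-ends : ∀ v → ends (red ⊕ edge x a) out₀ v ≡ ends red out v + δ v x
  red-ends v = ends-exchangeˡ red (edge x a) {g = unit a b} out≐
    (trans (row-edge x a v) (cong (δ v x +_) (sym (row-unit a b v))))
  blue-ends : ∀ v → ends (blue ⊕ edge x b) (out₀ ᵀ) v ≡ ends blue (out ᵀ) v + δ v x
  blue-ends v = ends-exchangeˡ blue (edge x b) {g = unit a b ᵀ} (λ u w → out≐ w u)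
    (trans (row-edge x b v) (cong (δ v x +_) (sym (row-unitᵀ a b v))))

-- The bicoloured path a → x → b replaces the bicoloured edge a → b: every vertex keeps its red and
-- blue ends, and x gains one of each.
reroute-bi : ∀ {n} {C M M′ : Mat n} {x a b : Fin n} → M ≐ M′ ⊕ (edge x a ⊕ edge x b) →
  (S : Balanced C (M′ ⊕ edge a b)) → 1 ≤ Balanced.out S a b → Balanced C M
reroute-bi {M′ = M′} {x} {a} {b} M≐ S 1≤out = record
  { red      = red
  ; blue     = blue
  ; out      = out₀ ⊕ path
  ; colours  = colours
  ; red-sym  = red-sym
  ; orients  = ≐-trans (orients-⊕ out₀ path (orients-remove {M = M′} out₀ (unit a b) out≐ orients) path-orients)
                      (≐-sym M≐)
  ; balanced = λ v → near-shift (δ v x) (balanced v) (red-ends v) (blue-ends v) }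
  where
  open Balanced S
  out₀ path : Mat _
  out₀ = out ⊖ unit a b
  path = unit x a ᵀ ⊕ unit x b
  out≐ : out ≐ out₀ ⊕ unit a b
  out≐ = ⊖-⊕ (unit-≤ 1≤out)
  path-orients : path ⊕ path ᵀ ≐ edge x a ⊕ edge x b
  path-orients u v = rearrange (unit x a v u) (unit x b u v) (unit x a u v) (unit x b v u)
    where
    rearrange : ∀ p q r s → (p + q) + (r + s) ≡ (r + p) + (q + s)
    rearrange = solve-∀
  red-ends : ∀ v → ends red (out₀ ⊕ path) v ≡ ends red out v + δ v x
  red-ends v = ends-exchangeʳ red path {g = unit a b} out≐ (begin
    row path v                               ≡⟨ row-⊕ (unit x a ᵀ) (unit x b) v ⟩
    row (unit x a ᵀ) v + row (unit x b) v    ≡⟨ cong₂ _+_ (row-unitᵀ x a v) (row-unit x b v) ⟩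
    δ v a + δ v x                            ≡⟨ cong (_+ δ v x) (row-unit a b v) ⟨
    row (unit a b) v + δ v x                 ∎)
    where open ≡-Reasoning
  blue-ends : ∀ v → ends blue ((out₀ ⊕ path) ᵀ) v ≡ ends blue (out ᵀ) v + δ v x
  blue-ends v = ends-exchangeʳ blue (path ᵀ) {g = unit a b ᵀ} (λ u w → out≐ w u) (begin
    row (path ᵀ) v                           ≡⟨ row-⊕ (unit x a) (unit x b ᵀ) v ⟩
    row (unit x a) v + row (unit x b ᵀ) v    ≡⟨ cong₂ _+_ (row-unit x a v) (row-unitᵀ x b v) ⟩
    δ v x + δ v b                            ≡⟨ +-comm (δ v x) (δ v b) ⟩
    δ v b + δ v x                            ≡⟨ cong (_+ δ v x) (row-unitᵀ a b v) ⟨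
    row (unit a b ᵀ) v + δ v x               ∎)
    where open ≡-Reasoning

reduce-mono-path : ∀ {n} {C M : Mat n} {x a b : Fin n} →
  Multigraph C → Multigraph M → Below C M → a ≢ b → 1 ≤ C x a → 1 ≤ C x b → Balanced C M
reduce-mono-path {C = C} {M} {x} {a} {b} mC mM below a≢b 1≤Cxa 1≤Cxb with remove-path mC a≢b 1≤Cxa 1≤Cxb
... | C′ , mC′ , C≐ =
  [ reroute-mono {M = M} C≐ S , reroute-mono {M = M} C≐′ S′ ]′
    (oriented-somewhere {o = Balanced.out S} {M} a≢b (Balanced.orients S))
  where
  C≐′ : C ≐ C′ ⊕ (edge x b ⊕ edge x a)
  C≐′ = ≐-trans C≐ (⊕-cong {f = C′} ≐-refl (⊕-comm (edge x a) (edge x b)))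
  weight-C : weight C M ≡ weight C′ (M ⊕ edge a b) + 2
  weight-C = begin
    size C + size M                    ≡⟨ cong (_+ size M) (trans (size-cong C≐) (size-two-edges C′ x a x b)) ⟩
    size C′ + 4 + size M               ≡⟨ shuffle (size C′) (size M) ⟩
    size C′ + (size M + 2) + 2         ≡⟨ cong (λ m → size C′ + m + 2) (size-⊕-edge M a b) ⟨
    weight C′ (M ⊕ edge a b) + 2       ∎
    where
    open ≡-Reasoning
    shuffle : ∀ c m → c + 4 + m ≡ c + (m + 2) + 2
    shuffle = solve-∀
  S : Balanced C′ (M ⊕ edge a b)
  S = below mC′ (⊕-edge-multigraph mM a≢b) (lighter 1 weight-C)
  S′ : Balanced C′ (M ⊕ edge b a)
  S′ = Balanced-cong ≐-refl (⊕-cong {f = M} ≐-refl (edge-comm a b)) S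

reduce-bi-path : ∀ {n} {C M : Mat n} {x a b : Fin n} →
  Multigraph C → Multigraph M → Below C M → a ≢ b → 1 ≤ M x a → 1 ≤ M x b → Balanced C M
reduce-bi-path {C = C} {M} {x} {a} {b} mC mM below a≢b 1≤Mxa 1≤Mxb with remove-path mM a≢b 1≤Mxa 1≤Mxb
... | M′ , mM′ , M≐ =
  [ reroute-bi {M′ = M′} M≐ S , reroute-bi {M′ = M′} M≐′ S′ ]′
    (oriented-somewhere {o = Balanced.out S} {M′} a≢b (Balanced.orients S))
  where
  M≐′ : M ≐ M′ ⊕ (edge x b ⊕ edge x a)
  M≐′ = ≐-trans M≐ (⊕-cong {f = M′} ≐-refl (⊕-comm (edge x a) (edge x b)))
  weight-M : weight C M ≡ weight C (M′ ⊕ edge a b) + 2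
  weight-M = begin
    size C + size M                    ≡⟨ cong (size C +_) (trans (size-cong M≐) (size-two-edges M′ x a x b)) ⟩
    size C + (size M′ + 4)             ≡⟨ shuffle (size C) (size M′) ⟩
    size C + (size M′ + 2) + 2         ≡⟨ cong (λ m → size C + m + 2) (size-⊕-edge M′ a b) ⟨
    weight C (M′ ⊕ edge a b) + 2       ∎
    where
    open ≡-Reasoning
    shuffle : ∀ c m → c + (m + 4) ≡ c + (m + 2) + 2
    shuffle = solve-∀
  S : Balanced C (M′ ⊕ edge a b)
  S = below mC (⊕-edge-multigraph mM′ a≢b) (lighter 1 weight-M)
  S′ : Balanced C (M′ ⊕ edge b a)
  S′ = Balanced-cong ≐-refl (⊕-cong {f = M′} ≐-refl (edge-comm a b)) S

some-positive : ∀ {m} (f : Fin m → ℕ) → 1 ≤ sum f → ∃[ w ] 1 ≤ f w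
some-positive {suc m} f 1≤∑f with f zero in f0
... | suc _ = zero , subst (1 ≤_) (sym f0) (s≤s z≤n)
... | zero  = let w , 1≤fw = some-positive (f ∘ suc) 1≤∑f in suc w , 1≤fw

two-ends : ∀ {m} (f : Fin m → ℕ) → 2 ≤ sum f →
  (∃[ w ] 2 ≤ f w) ⊎ (∃[ a ] ∃[ b ] a ≢ b × 1 ≤ f a × 1 ≤ f b)
two-ends {suc m} f 2≤∑f with f zero in f0
... | suc (suc _) = inj₁ (zero , subst (2 ≤_) (sym f0) (s≤s (s≤s z≤n)))
... | suc zero    =
  let w , 1≤fw = some-positive (f ∘ suc) (s≤s⁻¹ 2≤∑f)
  in inj₂ (zero , suc w , (λ ()) , subst (1 ≤_) (sym f0) ≤-refl , 1≤fw)
... | zero        = Sum.map shift-double shift-path (two-ends (f ∘ suc) 2≤∑f)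
  where
  shift-double : (∃[ w ] 2 ≤ f (suc w)) → ∃[ w ] 2 ≤ f w
  shift-double (w , 2≤fw) = suc w , 2≤fw
  shift-path : (∃[ a ] ∃[ b ] a ≢ b × 1 ≤ f (suc a) × 1 ≤ f (suc b)) →
               ∃[ a ] ∃[ b ] a ≢ b × 1 ≤ f a × 1 ≤ f b
  shift-path (a , b , a≢b , 1≤fa , 1≤fb) = suc a , suc b , a≢b ∘ Fin.suc-injective , 1≤fa , 1≤fb

at-most-one : ∀ {n} (f : Mat n) → ¬ (∃[ x ] 2 ≤ row f x) → ∀ v → row f v ≤ 1
at-most-one f no-vertex v = s≤s⁻¹ (≰⇒> (λ 2≤ → no-vertex (v , 2≤)))

reduce : ∀ {n} {C M : Mat n} → Multigraph C → Multigraph M → Below C M → Balanced C M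
reduce {C = C} {M} mC mM below with any? (λ x → 2 ≤? row C x) | any? (λ x → 2 ≤? row M x)
... | yes (x , 2≤Cx) | _ with two-ends (C x) 2≤Cx
...   | inj₁ (_ , 2≤Cxw)                 = reduce-mono-double mC mM below 2≤Cxw
...   | inj₂ (_ , _ , a≢b , 1≤Cxa , 1≤Cxb) = reduce-mono-path mC mM below a≢b 1≤Cxa 1≤Cxb
reduce {M = M} mC mM below | no _ | yes (x , 2≤Mx) with two-ends (M x) 2≤Mx
...   | inj₁ (_ , 2≤Mxw)                 = reduce-bi-double mC mM below 2≤Mxw
...   | inj₂ (_ , _ , a≢b , 1≤Mxa , 1≤Mxb) = reduce-bi-path mC mM below a≢b 1≤Mxa 1≤Mxb
reduce mC mM below | no C-sparse | no M-sparse =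
  balanced-sparse mC mM (at-most-one _ C-sparse) (at-most-one _ M-sparse)

balance-below : ∀ {n} k {C M : Mat n} → Multigraph C → Multigraph M → weight C M < k → Balanced C M
balance-below (suc k) mC mM w<k =
  reduce mC mM λ mC′ mM′ w′<w → balance-below k mC′ mM′ (<-≤-trans w′<w (s≤s⁻¹ w<k))

balance : ∀ {n} {C M : Mat n} → Multigraph C → Multigraph M → Balanced C M
balance {C = C} {M} mC mM = balance-below (suc (weight C M)) mC mM ≤-refl

near-without-bicoloured : ∀ {n} {C : Mat n} (S : Balanced C 𝟘) → ∀ v →
  Near (row (Balanced.red S) v) (row (Balanced.blue S) v)
near-without-bicoloured S v = subst₂ Near (ends-𝟘 red out-𝟘) (ends-𝟘 blue (λ u w → out-𝟘 w u)) (balanced v)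
  where
  open Balanced S
  out-𝟘 : out ≐ 𝟘
  out-𝟘 u w = m+n≡0⇒m≡0 (out u w) (orients u w)
  ends-𝟘 : ∀ f {o} → o ≐ 𝟘 → ends f o v ≡ row f v
  ends-𝟘 f o≐𝟘 = trans (cong (row f v +_) (trans (row-cong o≐𝟘 v) (row-𝟘 v))) (+-identityʳ (row f v))

χ : Bool → ℕ
χ true  = 1
χ false = 0

count : ∀ {n} → (Fin n → Bool) → ℕ
count {n} p = length (filterᵇ p (allFin n))

count-tabulate : ∀ {A : Set} {n} (p : A → Bool) (f : Fin n → A) →
  length (filterᵇ p (tabulate f)) ≡ ∑[ i < n ] χ (p (f i))
count-tabulate {n = zero}  p f = refl
count-tabulate {n = suc n} p f with p (f zero)
... | true  = cong suc (count-tabulate p (f ∘ suc))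
... | false = count-tabulate p (f ∘ suc)

count-sum : ∀ {n} (p : Fin n → Bool) → count p ≡ ∑[ i < n ] χ (p i)
count-sum p = count-tabulate p id

count-mono : ∀ {n} {p q : Fin n → Bool} → (∀ i → p i ≡ true → q i ≡ true) → count p ≤ count q
count-mono {p = p} {q} p⇒q = subst₂ _≤_ (sym (count-sum p)) (sym (count-sum q)) (∑-mono χ-mono)
  where
  χ-mono : ∀ i → χ (p i) ≤ χ (q i)
  χ-mono i with p i in pi
  ... | true rewrite p⇒q i pi = ≤-refl
  ... | false = z≤n

count-split : ∀ {n} (p q : Fin n → Bool) →
  count p ≡ count (λ i → p i ∧ q i) + count (λ i → p i ∧ not (q i))
count-split p q = begin
  count p                              ≡⟨ count-sum p ⟩
  sum (λ i → χ (p i))                  ≡⟨ sum-cong-≗ (λ i → χ-split (p i) (q i)) ⟩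
  sum (λ i → χ (both i) + χ (only i))  ≡⟨ ∑-distrib-+ (χ ∘ both) (χ ∘ only) ⟩
  sum (χ ∘ both) + sum (χ ∘ only)      ≡⟨ cong₂ _+_ (count-sum both) (count-sum only) ⟨
  count both + count only              ∎
  where
  open ≡-Reasoning
  both only : _ → Bool
  both i = p i ∧ q i
  only i = p i ∧ not (q i)
  χ-split : ∀ a b → χ a ≡ χ (a ∧ b) + χ (a ∧ not b)
  χ-split true  true  = refl
  χ-split true  false = refl
  χ-split false _     = refl

restrict : ∀ {n} (G : Graph n) (r : Fin n → Fin n → Bool) → (∀ u v → r u v ≡ r v u) → Graph n
restrict G r r-sym = record
  { adj    = λ u v → adj G u v ∧ r u v
  ; sym    = λ u v → cong₂ _∧_ (Graph.sym G u v) (r-sym u v)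
  ; irrefl = λ u → cong (_∧ r u u) (Graph.irrefl G u) }

_∖_ : ∀ {n} → Graph n → Graph n → Graph n
G ∖ H = restrict G (λ u v → not (adj H u v)) (λ u v → cong not (Graph.sym H u v))

deg-∖ : ∀ {n} {G H : Graph n} → SpanningSubgraph H G → ∀ u → deg (G ∖ H) u + deg H u ≤ deg G u
deg-∖ {G = G} {H} H⊆G u = begin
  deg (G ∖ H) u + deg H u                     ≤⟨ +-monoʳ-≤ (deg (G ∖ H) u) (count-mono H⇒G∧H) ⟩
  deg (G ∖ H) u + count (λ v → adj G u v ∧ adj H u v)  ≡⟨ +-comm (deg (G ∖ H) u) _ ⟩
  count (λ v → adj G u v ∧ adj H u v) + deg (G ∖ H) u  ≡⟨ count-split (adj G u) (adj H u) ⟨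
  deg G u                                     ∎
  where
  open ≤-Reasoning
  H⇒G∧H : ∀ v → adj H u v ≡ true → adj G u v ∧ adj H u v ≡ true
  H⇒G∧H v uv∈H rewrite H⊆G u v uv∈H | uv∈H = refl

deg-mono : ∀ {n} {G H : Graph n} → SpanningSubgraph H G → ∀ u → deg H u ≤ deg G u
deg-mono {G = G} {H} H⊆G u = ≤-trans (m≤n+m (deg H u) (deg (G ∖ H) u)) (deg-∖ {G = G} {H} H⊆G u)

redPart bluePart : ∀ {n} (G : Graph n) (r : Fin n → Fin n → Bool) → (∀ u v → r u v ≡ r v u) → Graph n
redPart  = restrict
bluePart G r r-sym = restrict G (λ u v → not (r u v)) (λ u v → cong not (r-sym u v))

record Halving {n} (G : Graph n) : Set where
  field
    isRed     : Fin n → Fin n → Bool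
    isRed-sym : ∀ u v → isRed u v ≡ isRed v u
    red-half  : ∀ u → 2 * deg (redPart G isRed isRed-sym) u ≤ deg G u + 2
    blue-half : ∀ u → 2 * deg (bluePart G isRed isRed-sym) u ≤ deg G u + 2

  red blue : Graph n
  red  = redPart G isRed isRed-sym
  blue = bluePart G isRed isRed-sym

half-of-near : ∀ {p q} → p ≤ q + 2 → 2 * p ≤ p + q + 2
half-of-near {p} {q} p≤ = begin
  2 * p        ≡⟨ cong (p +_) (+-identityʳ p) ⟩
  p + p        ≤⟨ +-monoʳ-≤ p p≤ ⟩
  p + (q + 2)  ≡⟨ +-assoc p q 2 ⟨
  p + q + 2    ∎
  where open ≤-Reasoning

count-by-weights : ∀ {n} (p : Fin n → Bool) (r b : Fin n → ℕ) → (∀ i → r i + b i ≡ χ (p i)) →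
  count (λ i → p i ∧ (0 <ᵇ r i)) ≡ sum r × count (λ i → p i ∧ not (0 <ᵇ r i)) ≡ sum b
count-by-weights p r b r+b≡χp =
    trans (count-sum (λ i → p i ∧ (0 <ᵇ r i))) (sum-cong-≗ (λ i → proj₁ (split (p i) (r i) (b i) (r+b≡χp i))))
  , trans (count-sum (λ i → p i ∧ not (0 <ᵇ r i))) (sum-cong-≗ (λ i → proj₂ (split (p i) (r i) (b i) (r+b≡χp i))))
  where
  split : ∀ g r b → r + b ≡ χ g → χ (g ∧ (0 <ᵇ r)) ≡ r × χ (g ∧ not (0 <ᵇ r)) ≡ b
  split true  zero       b    r+b≡1 = refl , sym r+b≡1
  split true  (suc zero) zero _     = refl , refl
  split false zero       zero _     = refl , refl

halving : ∀ {n} (G : Graph n) → Halving G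
halving {n} G = record
  { isRed     = isRed
  ; isRed-sym = λ u v → cong (0 <ᵇ_) (red-sym u v)
  ; red-half  = λ u → begin
      2 * count (red-at u)           ≡⟨ cong (2 *_) (proj₁ (counts u)) ⟩
      2 * row red u                 ≤⟨ half-of-near (proj₁ (near u)) ⟩
      row red u + row blue u + 2    ≡⟨ cong (_+ 2) (deg-count u) ⟨
      deg G u + 2                   ∎
  ; blue-half = λ u → begin
      2 * count (blue-at u)          ≡⟨ cong (2 *_) (proj₂ (counts u)) ⟩
      2 * row blue u                 ≤⟨ half-of-near (proj₂ (near u)) ⟩
      row blue u + row red u + 2     ≡⟨ cong (_+ 2) (trans (deg-count u) (+-comm (row red u) (row blue u))) ⟨
      deg G u + 2                    ∎ }
  where
  open ≤-Reasoning
  C : Mat n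
  C u v = χ (adj G u v)
  C-multigraph : Multigraph C
  C-multigraph = record { symmetric = λ u v → cong χ (Graph.sym G u v) ; loopless = λ u → cong χ (Graph.irrefl G u) }
  S : Balanced C 𝟘
  S = balance C-multigraph 𝟘-multigraph
  open Balanced S
  near : ∀ u → Near (row red u) (row blue u)
  near = near-without-bicoloured S
  isRed : Fin n → Fin n → Bool
  isRed u v = 0 <ᵇ red u v
  red-at blue-at : Fin n → Fin n → Bool
  red-at u v  = adj G u v ∧ isRed u v
  blue-at u v = adj G u v ∧ not (isRed u v)
  counts : ∀ u → count (red-at u) ≡ row red u × count (blue-at u) ≡ row blue u
  counts u = count-by-weights (adj G u) (red u) (blue u) (colours u)
  deg-count : ∀ u → deg G u ≡ row red u + row blue u
  deg-count u = trans (count-sum (adj G u)) (trans (sum-cong-≗ (λ v → sym (colours u v))) (row-⊕ red blue u))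

twice-≤ : ∀ c d → 4 ≤ d → 4 * c ≤ d + 6 → 2 * c ≤ d
twice-≤ 0 d _ _ = z≤n
twice-≤ 1 d 4≤d _ = ≤-trans (s≤s (s≤s z≤n)) 4≤d
twice-≤ 2 d 4≤d _ = 4≤d
twice-≤ (suc (suc (suc k))) d _ 4c≤d+6 = begin
  2 * (3 + k)  ≡⟨ *-distribˡ-+ 2 3 k ⟩
  6 + 2 * k    ≤⟨ +-monoʳ-≤ 6 (*-monoˡ-≤ k {2} {4} (s≤s (s≤s z≤n))) ⟩
  6 + 4 * k    ≤⟨ +-cancelʳ-≤ 6 (6 + 4 * k) d (subst (_≤ d + 6) (expand k) 4c≤d+6) ⟩
  d            ∎
  where
  open ≤-Reasoning
  expand : ∀ k → 4 * (3 + k) ≡ 6 + 4 * k + 6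
  expand = solve-∀

quarter-bound : ∀ {c e d} → 2 * c ≤ e + 2 → 2 * e ≤ d + 2 → 4 ≤ d → 2 * c ≤ d
quarter-bound {c} {e} {d} c≤ e≤ 4≤d = twice-≤ c d 4≤d (begin
  4 * c            ≡⟨ *-assoc 2 2 c ⟩
  2 * (2 * c)      ≤⟨ *-monoʳ-≤ 2 c≤ ⟩
  2 * (e + 2)      ≡⟨ *-distribˡ-+ 2 e 2 ⟩
  2 * e + 4        ≤⟨ +-monoˡ-≤ 4 e≤ ⟩
  d + 2 + 4        ≡⟨ +-assoc d 2 4 ⟩
  d + 6            ∎)
  where open ≤-Reasoning

sixColour : (h r r₁ r₂ s : Bool) → Fin 6
sixColour true  true  true  _     _     = 0F
sixColour true  true  false _     _     = 1F
sixColour true  false _     true  _     = 2F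
sixColour true  false _     false _     = 3F
sixColour false _     _     _     true  = 4F
sixColour false _     _     _     false = 5F

inH : Fin 6 → Bool
inH 0F = true
inH 1F = true
inH 2F = true
inH 3F = true
inH _  = false

inH-sixColour : ∀ h r r₁ r₂ s → inH (sixColour h r r₁ r₂ s) ≡ h
inH-sixColour true  true  true  _     _     = refl
inH-sixColour true  true  false _     _     = refl
inH-sixColour true  false _     true  _     = refl
inH-sixColour true  false _     false _     = refl
inH-sixColour false _     _     _     true  = refl
inH-sixColour false _     _     _     false = refl

module SixColouring {n} {G H : Graph n} (H⊆G : SpanningSubgraph H G) where
  open Halving

  S : Halving H
  S  = halving H
  S₁ : Halving (red S)
  S₁ = halving (red S)
  S₂ : Halving (blue S)
  S₂ = halving (blue S)
  T : Halving (G ∖ H)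
  T  = halving (G ∖ H)

  colour : Fin n → Fin n → Fin 6
  colour u v = sixColour (adj H u v) (isRed S u v) (isRed S₁ u v) (isRed S₂ u v) (isRed T u v)

  colour-sym : ∀ u v → colour u v ≡ colour v u
  colour-sym u v
    rewrite Graph.sym H u v | isRed-sym S u v | isRed-sym S₁ u v | isRed-sym S₂ u v | isRed-sym T u v = refl

  class : Fin 6 → Graph n
  class 0F = red S₁
  class 1F = blue S₁
  class 2F = red S₂
  class 3F = blue S₂
  class 4F = red T
  class 5F = blue T

  colour-class : ∀ u v → adj G u v ≡ true → adj (class (colour u v)) u v ≡ true
  colour-class u v uv∈G
    with adj H u v in h | isRed S u v in r | isRed S₁ u v in r₁ | isRed S₂ u v in r₂ | isRed T u v in t
  ... | true  | true  | true  | _     | _     rewrite h | r | r₁       = refl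
  ... | true  | true  | false | _     | _     rewrite h | r | r₁       = refl
  ... | true  | false | _     | true  | _     rewrite h | r | r₂       = refl
  ... | true  | false | _     | false | _     rewrite h | r | r₂       = refl
  ... | false | _     | _     | _     | true  rewrite uv∈G | h | t = refl
  ... | false | _     | _     | _     | false rewrite uv∈G | h | t = refl

  colouring : EdgeColoring G 6
  colouring = record { col = colour ; colSym = λ u v _ → colour-sym u v }

  bound-through-H : MinDegAtLeast 4 H → ∀ (K L : Graph n) {u} →
    2 * deg K u ≤ deg L u + 2 → 2 * deg L u ≤ deg H u + 2 → 2 * deg K u ≤ deg G u
  bound-through-H δH≥4 K L {u} K≤ L≤ =
    ≤-trans (quarter-bound {deg K u} {deg L u} K≤ L≤ (δH≥4 u)) (deg-mono {G = G} {H} H⊆G u)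

  bound-through-rest : MinDegAtLeast 4 H → ∀ (K : Graph n) {u} →
    2 * deg K u ≤ deg (G ∖ H) u + 2 → 2 * deg K u ≤ deg G u
  bound-through-rest δH≥4 K {u} c≤ =
    ≤-trans c≤ (≤-trans (+-monoʳ-≤ (deg (G ∖ H) u) (≤-trans (s≤s (s≤s z≤n)) (δH≥4 u)))
                        (deg-∖ {G = G} {H} H⊆G u))

  class-bound : MinDegAtLeast 4 H → ∀ α u → 2 * deg (class α) u ≤ deg G u
  class-bound δH≥4 0F u = bound-through-H δH≥4 (red S₁)  (red S)  (red-half S₁ u)  (red-half S u)
  class-bound δH≥4 1F u = bound-through-H δH≥4 (blue S₁) (red S)  (blue-half S₁ u) (red-half S u)
  class-bound δH≥4 2F u = bound-through-H δH≥4 (red S₂)  (blue S) (red-half S₂ u)  (blue-half S u)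
  class-bound δH≥4 3F u = bound-through-H δH≥4 (blue S₂) (blue S) (blue-half S₂ u) (blue-half S u)
  class-bound δH≥4 4F u = bound-through-rest δH≥4 (red T)  (red-half T u)
  class-bound δH≥4 5F u = bound-through-rest δH≥4 (blue T) (blue-half T u)

  majority : MinDegAtLeast 4 H → Majority colouring
  majority δH≥4 u α = ≤-trans (*-monoʳ-≤ 2 (count-mono in-class)) (class-bound δH≥4 α u)
    where
    in-class : ∀ v → adj G u v ∧ ⌊ colour u v ≟ α ⌋ ≡ true → adj (class α) u v ≡ true
    in-class v coloured-α with adj G u v in uv∈G | colour u v ≟ α
    ... | true | yes refl = colour-class u v uv∈G

  distinguishing : Asymmetric H → Distinguishing colouring
  distinguishing H-asym φ φ-aut φ-col = H-asym φ φ-aut-H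
    where
    non-edge : ∀ {u v} → adj G u v ≡ false → adj H u v ≡ false
    non-edge {u} {v} uv∉G with adj H u v in uv∈H
    ... | false = refl
    ... | true  = contradiction (trans (sym (H⊆G u v uv∈H)) uv∉G) λ ()
    colour-inH : ∀ u v → inH (colour u v) ≡ adj H u v
    colour-inH u v = inH-sixColour (adj H u v) (isRed S u v) (isRed S₁ u v) (isRed S₂ u v) (isRed T u v)
    φ-aut-H : IsAutomorphism H φ
    φ-aut-H u v with adj G u v in uv∈G
    ... | true  = begin
      adj H (φ ⟨$⟩ʳ u) (φ ⟨$⟩ʳ v)    ≡⟨ colour-inH (φ ⟨$⟩ʳ u) (φ ⟨$⟩ʳ v) ⟨
      inH (colour (φ ⟨$⟩ʳ u) (φ ⟨$⟩ʳ v))  ≡⟨ cong inH (φ-col u v uv∈G) ⟩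
      inH (colour u v)                ≡⟨ colour-inH u v ⟩
      adj H u v                       ∎
      where open ≡-Reasoning
    ... | false = trans (non-edge (trans (φ-aut u v) uv∈G)) (sym (non-edge uv∈G))

corollary10 : ∀ (n : ℕ) (G : Graph n) → MinDegAtLeast 4 G →
    Σ (Graph n) (λ H → SpanningSubgraph H G × Connected H × Asymmetric H × MinDegAtLeast 4 H) →
    Σ (EdgeColoring G 6) (λ c → Majority c × Distinguishing c)
corollary10 n G _ (H , H⊆G , _ , H-asym , δH≥4) = colouring , majority δH≥4 , distinguishing H-asym
  where open SixColouring {G = G} {H} H⊆G
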